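{- For $n\geq 9$, $a_n(123;321) = 0$.
   Context: $\mathcal{S}_n$ is the set of permutations of $[n]=\{1,\dots,n\}$, written in one-line notation $\pi=\pi_1\pi_2\cdots\pi_n$ with $\pi_i=\pi(i)$. A permutation is cyclic if it consists of exactly one $n$-cycle. For a cyclic $\pi$, its standard cycle notation is $C(\pi)=(c_1,c_2,\dots,c_n)$ with $c_1=1$ and $c_i=\pi_{c_{i-1}}$ for $2\le i\le n$. A sequence of distinct integers $w_1\cdots w_m$ contains a pattern $\sigma\in\mathcal{S}_k$ if there are indices $i_1<\dots<i_k$ with $w_{i_1}\cdots w_{i_k}$ in the same relative order as $\sigma_1\cdots\sigma_k$; otherwise it avoids $\sigma$. For $\sigma,\tau\in\mathcal{S}_3$, $\mathcal{A}_n(\sigma;\tau)$ is the set of cyclic permutations $\pi\in\mathcal{S}_n$ whose one-line notation avoids $\sigma$ and whose cycle notation $C(\pi)$ (as the sequence $c_1c_2\cdots c_n$) avoids $\tau$; $a_n(\sigma;\tau)=|\mathcal{A}_n(\sigma;\tau)|$. -}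

module Defs where

open import Data.Nat using (ℕ; zero; suc; _<_)
open import Data.Fin using (Fin; toℕ)
import Data.Fin as F
open import Data.Fin.Permutation using (Permutation′; _⟨$⟩ʳ_)
open import Data.Product using (∃; _×_)
open import Function using (_⇔_)
open import Relation.Binary.PropositionalEquality using (_≡_)
open import Relation.Nullary using (¬_)

-- Convention: [n] = {1,…,n} is represented by Fin n, with element i+1 ↔ Fin value i.
-- Pattern containment only depends on relative order, which this shift preserves.

iter : ∀ {n} → Permutation′ n → ℕ → Fin n → Fin n
iter π zero    x = x
iter π (suc k) x = π ⟨$⟩ʳ (iter π k x)

IsCyclic : ∀ {n} → Permutation′ n → Set
IsCyclic {n} π = ∀ (x y : Fin n) → ∃ λ k → iter π k x ≡ y

oneLine : ∀ {n} → Permutation′ n → Fin n → ℕ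
oneLine π i = toℕ (π ⟨$⟩ʳ i)

-- standard cycle notation (c₁,…,cₙ) with c₁ = 1 (= Fin zero) and c_{i} = π(c_{i-1}):
-- the i-th entry (0-indexed) is π^i(1)
cycleNotation : ∀ {m} → Permutation′ (suc m) → Fin (suc m) → ℕ
cycleNotation π i = toℕ (iter π (toℕ i) F.zero)

Contains : ∀ {k m} → (Fin k → Fin k) → (Fin m → ℕ) → Set
Contains {k} {m} σ w =
  ∃ λ (ι : Fin k → Fin m) →
    (∀ (a b : Fin k) → a F.< b → ι a F.< ι b) ×
    (∀ (a b : Fin k) → (w (ι a) < w (ι b)) ⇔ (σ a F.< σ b))

Avoids : ∀ {k m} → (Fin k → Fin k) → (Fin m → ℕ) → Set
Avoids σ w = ¬ Contains σ w

p123 : Fin 3 → Fin 3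
p123 i = i

p321 : Fin 3 → Fin 3
p321 F.zero = F.suc (F.suc F.zero)
p321 (F.suc F.zero) = F.suc F.zero
p321 (F.suc (F.suc F.zero)) = F.zero

InA : ∀ {m} → (Fin 3 → Fin 3) → (Fin 3 → Fin 3) → Permutation′ (suc m) → Set
InA σ τ π = IsCyclic π × Avoids σ (oneLine π) × Avoids τ (cycleNotation π)

-- Write x t = π^t(1) for the entries of the cycle notation. Since π(x t) = x (t + 1), indices
-- with x i < x j < x l and x (i+1) < x (j+1) < x (l+1) give a 123 in the one-line notation, and
-- a decreasing triple among x 0, …, x 8 is a 321 in the cycle notation; moreover x 0 = 1 is the
-- least entry, and x 0, …, x 8 are distinct because π is a single n-cycle with n ≥ 9. No
-- ordering of nine distinct values meets all these constraints: inserting x 0, x 1, … one at a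
-- time into a sorted list and discarding a branch as soon as a constraint fails closes every
-- branch. The search is carried out by evaluation, once it is shown that a search closing all
-- branches rules out every ordering.
module Submission where

open import Defs
open import Data.Nat using (ℕ; zero; suc; _+_; _∸_; _<_; _≤_; _≟_; z≤n; s≤s)
open import Data.Nat.Properties
  using (<-trans; ≤-trans; <-cmp; <-asym; <-irrefl; +-suc; m<m+n; m<n⇒m<1+n; n<1+n; m≤n⇒m<n∨m≡n;
         m<n⇒0<n∸m; m∸n≤m; m+[n∸m]≡n; <⇒≤)
open import Data.Fin using (Fin; toℕ; fromℕ<; inject₁)
import Data.Fin as F
open import Data.Fin.Properties using (toℕ-injective; toℕ-fromℕ<; toℕ<n; pigeonhole; any?)
import Data.Fin.Properties as F
open import Data.Fin.Patterns using (0F; 1F; 2F)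
open import Data.Fin.Permutation using (Permutation′; _⟨$⟩ʳ_)
open import Data.List using (List; []; _∷_; map)
open import Data.List.Membership.Propositional using (_∈_)
open import Data.List.Membership.DecPropositional _≟_ using (_∈?_)
open import Data.List.Relation.Unary.All as All using (All; []; _∷_)
open import Data.List.Relation.Unary.All.Properties using (map⁻)
open import Data.List.Relation.Unary.AllPairs using (AllPairs; []; _∷_)
open import Data.List.Relation.Binary.Permutation.Propositional using (_↭_; refl; prep; swap; ↭-sym; ↭-trans)
open import Data.List.Relation.Binary.Permutation.Propositional.Properties using (All-resp-↭)
open import Data.Product using (∃; ∃₂; _×_; _,_; proj₁; proj₂)
open import Data.Sum using (_⊎_; inj₁; inj₂; [_,_])
open import Data.Empty using (⊥; ⊥-elim)
open import Data.Vec using ([]; _∷_; lookup)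
open import Function using (_∘_; mk⇔)
open import Function.Bundles using (Injection)
open import Function.Definitions using (Injective)
open import Function.Properties.Inverse using (↔⇒↣)
open import Relation.Binary using (Transitive; Decidable; tri<; tri≈; tri>)
open import Relation.Binary.PropositionalEquality using (_≡_; _≢_; refl; sym; trans; cong; subst; subst₂)
open import Relation.Nullary using (¬_; Dec; no)
open import Relation.Nullary.Decidable using (_×-dec_; _⊎-dec_; from-yes)

module _ {n} (π : Permutation′ n) where

  iter-+ : ∀ i k y → iter π (i + k) y ≡ iter π i (iter π k y)
  iter-+ zero    k y = refl
  iter-+ (suc i) k y = cong (π ⟨$⟩ʳ_) (iter-+ i k y)

  iter-injective : ∀ i {a b} → iter π i a ≡ iter π i b → a ≡ b
  iter-injective zero    eq = eq
  iter-injective (suc i) eq = iter-injective i (Injection.injective (↔⇒↣ π) eq)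

  iter-periodic : ∀ {p y} → 0 < p → iter π p y ≡ y → ∀ k → ∃ λ r → r < p × iter π k y ≡ iter π r y
  iter-periodic 0<p period zero = 0 , 0<p , refl
  iter-periodic 0<p period (suc k) with iter-periodic 0<p period k
  ... | r , r<p , eq with m≤n⇒m<n∨m≡n r<p
  ...   | inj₁ r+1<p = suc r , r+1<p , cong (π ⟨$⟩ʳ_) eq
  ...   | inj₂ refl  = 0 , 0<p , trans (cong (π ⟨$⟩ʳ_) eq) period

  -- A period p < n would confine every orbit, hence all of Fin n, to p points.
  cyclic⇒no-short-period : IsCyclic π → ∀ {p y} → 0 < p → p < n → iter π p y ≢ y
  cyclic⇒no-short-period cyclic {p} {y} 0<p p<n period =
    let i , j , i<j , same = pigeonhole p<n index
    in  F.<-irrefl (trans (sym (index-sound i))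
                          (trans (cong (λ r → iter π (toℕ r) y) same) (index-sound j)))
                   i<j
    where
      residue : ∀ z → ∃ λ r → r < p × iter π (proj₁ (cyclic y z)) y ≡ iter π r y
      residue z = iter-periodic 0<p period (proj₁ (cyclic y z))

      index : Fin n → Fin p
      index z = fromℕ< (proj₁ (proj₂ (residue z)))

      index-sound : ∀ z → iter π (toℕ (index z)) y ≡ z
      index-sound z = trans (cong (λ t → iter π t y) (toℕ-fromℕ< (proj₁ (proj₂ (residue z)))))
                            (trans (sym (proj₂ (proj₂ (residue z)))) (proj₂ (cyclic y z)))

  cyclic⇒iter-injective : IsCyclic π → ∀ y {i j} → i < j → j < n → iter π i y ≢ iter π j y
  cyclic⇒iter-injective cyclic y {i} {j} i<j j<n eq =
    cyclic⇒no-short-period cyclic (m<n⇒0<n∸m i<j) (≤-trans (s≤s (m∸n≤m j i)) j<n) (sym returns)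
    where
      returns : y ≡ iter π (j ∸ i) y
      returns = iter-injective i (trans eq (trans (cong (λ t → iter π t y) (sym (m+[n∸m]≡n (<⇒≤ i<j))))
                                                   (iter-+ i (j ∸ i) y)))

increasing-from-steps : ∀ {n} (v : Fin (suc n) → ℕ) → (∀ i → v (inject₁ i) < v (F.suc i)) →
                        ∀ {a b} → a F.< b → v a < v b
increasing-from-steps v step {0F} {1F} _ = step 0F
increasing-from-steps {suc n} v step {0F} {F.suc (F.suc b)} _ =
  <-trans (step 0F) (increasing-from-steps (v ∘ F.suc) (step ∘ F.suc) {0F} {F.suc b} (s≤s z≤n))
increasing-from-steps {suc n} v step {F.suc a} {F.suc b} (s≤s a<b) =
  increasing-from-steps (v ∘ F.suc) (step ∘ F.suc) a<b

-- The converse order condition follows from trichotomy, so one direction suffices.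
order-embedding⇒contains : ∀ {k m} {σ : Fin k → Fin k} {w : Fin m → ℕ} → Injective _≡_ _≡_ σ →
                           (ι : Fin k → Fin m) → (∀ a b → a F.< b → ι a F.< ι b) →
                           (∀ a b → σ a F.< σ b → w (ι a) < w (ι b)) → Contains σ w
order-embedding⇒contains {σ = σ} {w} σ-injective ι ι-increasing follows-σ =
  ι , ι-increasing , λ a b → mk⇔ (reflects a b) (follows-σ a b)
  where
    reflects : ∀ a b → w (ι a) < w (ι b) → σ a F.< σ b
    reflects a b w< with F.<-cmp (σ a) (σ b)
    ... | tri< σ< _ _ = σ<
    ... | tri≈ _ σ≡ _ = ⊥-elim (<-irrefl (cong (w ∘ ι) (σ-injective σ≡)) w<)
    ... | tri> _ _ σ> = ⊥-elim (<-asym w< (follows-σ b a σ>))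

p321-involutive : ∀ a → p321 (p321 a) ≡ a
p321-involutive 0F = refl
p321-involutive 1F = refl
p321-involutive 2F = refl

increasing-triple⇒contains-123 : ∀ {m} {w : Fin m → ℕ} {p q r : Fin m} → p F.< q → q F.< r →
                                 w p < w q → w q < w r → Contains p123 w
increasing-triple⇒contains-123 {w = w} {p} {q} {r} p<q q<r wp<wq wq<wr =
  order-embedding⇒contains {w = w} (λ eq → eq) ι
    (λ _ _ → increasing-from-steps (toℕ ∘ ι) λ { 0F → p<q ; 1F → q<r })
    (λ _ _ → increasing-from-steps (w ∘ ι) λ { 0F → wp<wq ; 1F → wq<wr })
  where ι = lookup (p ∷ q ∷ r ∷ [])

decreasing-triple⇒contains-321 : ∀ {m} {w : Fin m → ℕ} {p q r : Fin m} → p F.< q → q F.< r →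
                                 w q < w p → w r < w q → Contains p321 w
decreasing-triple⇒contains-321 {w = w} {p} {q} {r} p<q q<r wq<wp wr<wq =
  order-embedding⇒contains {w = w} p321-injective ι
    (λ _ _ → increasing-from-steps (toℕ ∘ ι) λ { 0F → p<q ; 1F → q<r })
    (λ a b σa<σb → subst₂ (λ a′ b′ → w (ι a′) < w (ι b′)) (p321-involutive a) (p321-involutive b)
                     (increasing-from-steps (w ∘ ι ∘ p321) (λ { 0F → wr<wq ; 1F → wq<wp }) σa<σb))
  where
    ι = lookup (p ∷ q ∷ r ∷ [])

    p321-injective : Injective _≡_ _≡_ p321
    p321-injective {a} {b} eq = trans (sym (p321-involutive a)) (trans (cong p321 eq) (p321-involutive b))

decreasing-values⇒contains-321 : ∀ {n} (f : ℕ → ℕ) {i j l} → i < j → j < l → l < n →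
                                 f j < f i → f l < f j → Contains p321 (f ∘ toℕ {n})
decreasing-values⇒contains-321 {n} f {i} {j} {l} i<j j<l l<n fj<fi fl<fj =
  decreasing-triple⇒contains-321 {w = f ∘ toℕ}
    (via-fromℕ< _<_ i<n j<n i<j) (via-fromℕ< _<_ j<n l<n j<l)
    (via-fromℕ< (λ s t → f s < f t) j<n i<n fj<fi) (via-fromℕ< (λ s t → f s < f t) l<n j<n fl<fj)
  where
    j<n = <-trans j<l l<n
    i<n = <-trans i<j j<n

    via-fromℕ< : ∀ (R : ℕ → ℕ → Set) {s t} (s<n : s < n) (t<n : t < n) →
                 R s t → R (toℕ (fromℕ< s<n)) (toℕ (fromℕ< t<n))
    via-fromℕ< R s<n t<n = subst₂ R (sym (toℕ-fromℕ< s<n)) (sym (toℕ-fromℕ< t<n))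

module _ {A : Set} where

  Precedes : List A → A → A → Set
  Precedes []      b c = ⊥
  Precedes (d ∷ L) b c = (d ≡ b × c ∈ L) ⊎ Precedes L b c

  allPairs-precedes : ∀ {ℓ} {R : A → A → Set ℓ} {L b c} → AllPairs R L → Precedes L b c → R b c
  allPairs-precedes (d≺L ∷ _) (inj₁ (refl , c∈L)) = All.lookup d≺L c∈L
  allPairs-precedes (_ ∷ sorted) (inj₂ precedes)  = allPairs-precedes sorted precedes

  insertions : A → List A → List (List A)
  insertions y []      = (y ∷ []) ∷ []
  insertions y (b ∷ L) = (y ∷ b ∷ L) ∷ map (b ∷_) (insertions y L)

  sorted-insertion : ∀ {ℓ ℓ′} {R : A → A → Set ℓ} {P : List A → Set ℓ′} {y L} → Transitive R →
                     AllPairs R L → All (λ b → R b y ⊎ R y b) L → All P (insertions y L) →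
                     ∃ λ L′ → P L′ × AllPairs R L′ × L′ ↭ y ∷ L
  sorted-insertion {y = y} {[]} _ [] [] (P[y] ∷ []) = y ∷ [] , P[y] , [] ∷ [] , refl
  sorted-insertion {y = y} {b ∷ L} ≺-trans (b≺L ∷ sorted) (comparable ∷ comparables) (P[ybL] ∷ P[b∷_])
    with comparable
  ... | inj₂ y≺b = y ∷ b ∷ L , P[ybL] , (y≺b ∷ All.map (≺-trans y≺b) b≺L) ∷ b≺L ∷ sorted , refl
  ... | inj₁ b≺y =
    let L′ , P[bL′] , sorted′ , L′↭ = sorted-insertion ≺-trans sorted comparables (map⁻ P[b∷_])
    in  b ∷ L′ , P[bL′] , All-resp-↭ (↭-sym L′↭) (b≺y ∷ b≺L) ∷ sorted′ ,
        ↭-trans (prep b L′↭) (swap b y refl)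

precedes? : ∀ L (b c : ℕ) → Dec (Precedes L b c)
precedes? []      b c = no λ ()
precedes? (d ∷ L) b c = (d ≟ b ×-dec c ∈? L) ⊎-dec precedes? L b c

-- Violated _≺_ k is meant to collect the constraints whose largest index is k, so that a branch
-- is pruned as soon as k has been inserted.
module LinearOrderSearch
  (Violated : (ℕ → ℕ → Set) → ℕ → Set)
  (violated? : ∀ L k → Dec (Violated (Precedes L) k))
  (violated-mono : ∀ {_≺_ _≺′_ : ℕ → ℕ → Set} → (∀ {a b} → a ≺ b → a ≺′ b) →
                   ∀ {k} → Violated _≺_ k → Violated _≺′_ k)
  where

  Refuted : ℕ → ℕ → List ℕ → Set
  Refuted zero    k L = ⊥
  Refuted (suc r) k L = All (λ L′ → Violated (Precedes L′) k ⊎ Refuted r (suc k) L′) (insertions k L)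

  refuted? : ∀ r k L → Dec (Refuted r k L)
  refuted? zero    k L = no λ ()
  refuted? (suc r) k L =
    All.all? (λ L′ → violated? L′ k ⊎-dec refuted? r (suc k) L′) (insertions k L)

  module _ {n} (x : ℕ → ℕ) (distinct : ∀ {i j} → i < j → j < n → x i ≢ x j)
           (satisfied : ∀ {k} → k < n → ¬ Violated (λ a b → x a < x b) k) where

    refuted-sound : ∀ r {k L} → k + r ≡ n → AllPairs (λ a b → x a < x b) L → All (_< k) L →
                    ¬ Refuted r k L
    refuted-sound zero    _ _ _ ()
    refuted-sound (suc r) {k} k+r≡n sorted bounded refuted =
      let L′ , violated-or-refuted , sorted′ , L′↭ =
            sorted-insertion <-trans sorted (All.map comparable bounded) refuted
      in  [ satisfied k<n ∘ violated-mono (allPairs-precedes sorted′)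
          , refuted-sound r (trans (sym (+-suc k r)) k+r≡n) sorted′
              (All-resp-↭ (↭-sym L′↭) (n<1+n k ∷ All.map m<n⇒m<1+n bounded))
          ] violated-or-refuted
      where
        k<n : k < n
        k<n = subst (k <_) k+r≡n (m<m+n k (s≤s z≤n))

        comparable : ∀ {a} → a < k → x a < x k ⊎ x k < x a
        comparable {a} a<k with <-cmp (x a) (x k)
        ... | tri< xa<xk _ _ = inj₁ xa<xk
        ... | tri≈ _ xa≡xk _ = ⊥-elim (distinct a<k k<n xa≡xk)
        ... | tri> _ _ xk<xa = inj₂ xk<xa

-- Read a ≺ b as x a < x b, where x t = π^t(1) is the t-th entry of the cycle notation; as
-- π(x t) = x (t + 1), the third kind of obstruction is a 123 at positions x i, x j, x l of the
-- one-line notation.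
module _ (_≺_ : ℕ → ℕ → Set) where

  BelowStart : ℕ → Set
  BelowStart k = k ≺ 0

  DecreasingTriple : ℕ → Set
  DecreasingTriple k = ∃₂ λ (i j : Fin k) → i F.< j × toℕ j ≺ toℕ i × k ≺ toℕ j

  IncreasingSuccessorTriple : ℕ → Set
  IncreasingSuccessorTriple k = ∃₂ λ (i j : Fin k) → ∃ λ (l : Fin k) →
    toℕ i ≺ toℕ j × toℕ j ≺ toℕ l × suc (toℕ i) ≺ suc (toℕ j) × suc (toℕ j) ≺ suc (toℕ l)

  Obstruction : ℕ → Set
  Obstruction k = BelowStart k ⊎ DecreasingTriple k ⊎ IncreasingSuccessorTriple k

obstruction? : ∀ {_≺_} → Decidable _≺_ → ∀ k → Dec (Obstruction _≺_ k)
obstruction? _≺?_ k =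
  k ≺? 0
  ⊎-dec any? (λ i → any? λ j → (i F.<? j) ×-dec (toℕ j ≺? toℕ i) ×-dec (k ≺? toℕ j))
  ⊎-dec any? (λ i → any? λ j → any? λ l →
          (toℕ i ≺? toℕ j) ×-dec (toℕ j ≺? toℕ l) ×-dec
          (suc (toℕ i) ≺? suc (toℕ j)) ×-dec (suc (toℕ j) ≺? suc (toℕ l)))

obstruction-mono : ∀ {_≺_ _≺′_ : ℕ → ℕ → Set} → (∀ {a b} → a ≺ b → a ≺′ b) →
                   ∀ {k} → Obstruction _≺_ k → Obstruction _≺′_ k
obstruction-mono f (inj₁ below)                                 = inj₁ (f below)
obstruction-mono f (inj₂ (inj₁ (i , j , i<j , ji , kj)))        = inj₂ (inj₁ (i , j , i<j , f ji , f kj))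
obstruction-mono f (inj₂ (inj₂ (i , j , l , ij , jl , ij′ , jl′))) =
  inj₂ (inj₂ (i , j , l , f ij , f jl , f ij′ , f jl′))

open LinearOrderSearch Obstruction (λ L → obstruction? (precedes? L)) obstruction-mono

theorem6p2 : ∀ (m : ℕ) → 9 ≤ suc m → ∀ (π : Permutation′ (suc m)) → ¬ InA p123 p321 π
theorem6p2 m 9≤n π (cyclic , avoids-123 , avoids-321) =
  refuted-sound x distinct satisfied 9 refl [] [] (from-yes (refuted? 9 0 []))
  where
    x : ℕ → ℕ
    x t = toℕ (iter π t F.zero)

    distinct : ∀ {i j} → i < j → j < 9 → x i ≢ x j
    distinct i<j j<9 = cyclic⇒iter-injective π cyclic F.zero i<j (≤-trans j<9 9≤n) ∘ toℕ-injective

    satisfied : ∀ {k} → k < 9 → ¬ Obstruction (λ a b → x a < x b) k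
    satisfied _   (inj₁ ())  -- x 0 = toℕ 0F = 0
    satisfied k<9 (inj₂ (inj₁ (i , j , i<j , xj<xi , xk<xj))) =
      avoids-321 (decreasing-values⇒contains-321 x i<j (toℕ<n j) (≤-trans k<9 9≤n) xj<xi xk<xj)
    satisfied _   (inj₂ (inj₂ (_ , _ , _ , xi<xj , xj<xl , πxi<πxj , πxj<πxl))) =
      avoids-123 (increasing-triple⇒contains-123 {w = oneLine π} xi<xj xj<xl πxi<πxj πxj<πxl)
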